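{- Let $\mathcal{V}=(Q,\Sigma,\Delta)$ be a $d$-TVASS and let $L$ be a linear path scheme bounded from a configuration $p(\vec{x})$. For every configuration $q(\vec{y})$ such that $p(\vec{x})\xrightarrow{L}q(\vec{y})$, we have $$\|\vec{y}\|\leq (\|\vec{x}\|+|L|\,\|\Sigma\|)\,(1+|L|\,\|\Sigma\|)^{|L|_*}.$$
   Context: A $d$-TVASS is a triple $\mathcal{V}=(Q,\Sigma,\Delta)$ with $Q$ a finite set of states, $\Sigma\subseteq\mathbb{Z}^d\cup\{\mathtt{tst}\}$ a finite set of actions, $\Delta\subseteq Q\times\Sigma\times Q$ a finite set of transitions. Configurations are $q(\vec{x})$ with $\vec{x}\in\mathbb{N}^d$. An addition transition $(p,\vec{a},q)$ gives a step $p(\vec{x})\to q(\vec{x}+\vec{a})$ if $\vec{x}+\vec{a}\in\mathbb{N}^d$; a zero-test transition $(p,\mathtt{tst},q)$ gives a step $p(\vec{x})\to q(\vec{x})$ if $\vec{x}(1)=0$. A path is a finite sequence of consecutive transitions, a cycle is a path starting and ending in the same state, and $p(\vec{x})\xrightarrow{\pi}q(\vec{y})$ means $\pi$ can be executed from $p(\vec{x})$ reaching $q(\vec{y})$. $\|\cdot\|$ is the max norm and $\|\Sigma\|$ is the maximum of $\|\vec{a}\|$ over $\vec{a}\in\Sigma\cap\mathbb{Z}^d$ (0 if none). A linear path scheme is a regular expression $L=\alpha_0\beta_1^*\alpha_1\cdots\beta_k^*\alpha_k$ with paths $\alpha_i$ and cycles $\beta_i$ such that $\alpha_0\beta_1\alpha_1\cdots\beta_k\alpha_k$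 is a path; $|L|=|\alpha_0\beta_1\alpha_1\cdots\beta_k\alpha_k|$ and $|L|_*=k$; $p(\vec{x})\xrightarrow{L}q(\vec{y})$ means $p(\vec{x})\xrightarrow{\pi}q(\vec{y})$ for some path $\pi$ in the language of $L$. $L$ is bounded from $p(\vec{x})$ if the set of configurations $r(\vec{z})$ such that $p(\vec{x})\xrightarrow{\pi}r(\vec{z})$ for some prefix $\pi$ of a path in the language of $L$ is finite. -}

module Defs where

open import Data.Nat using (ℕ; zero; suc; _+_; _*_; _⊔_; _^_; _≤_)
open import Data.Integer using (ℤ; +_; ∣_∣) renaming (_+_ to _+ℤ_)
open import Data.Fin using (Fin; toℕ)
open import Data.Vec using (Vec; lookup; foldr)
open import Data.List using (List; []; _∷_; _++_; length; concat; map; replicate)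
open import Data.List.Membership.Propositional using (_∈_)
open import Data.List.Relation.Unary.All using (All)
open import Data.Product using (_×_; _,_; Σ; ∃; proj₁; proj₂)
open import Relation.Binary.PropositionalEquality using (_≡_)

-- Actions of a d-TVASS: addition of a vector in ℤ^d, or the zero test on counter 1.
data Act (d : ℕ) : Set where
  add : Vec ℤ d → Act d
  tst : Act d

record TVASS (d : ℕ) : Set where
  field
    nQ : ℕ
    Sig : List (Act d)
    Delta : List (Fin nQ × Act d × Fin nQ)
    Delta⊆QΣQ : All (λ t → proj₁ (proj₂ t) ∈ Sig) Delta
open TVASS public

module _ {d : ℕ} (V : TVASS d) where

  State : Set
  State = Fin (nQ V)

  Trans : Set
  Trans = State × Act d × State

  src : Trans → State
  src (p , _ , _) = p

  tgt : Trans → State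
  tgt (_ , _ , q) = q

  Config : Set
  Config = State × Vec ℕ d

  ActStep : Act d → Vec ℕ d → Vec ℕ d → Set
  ActStep (add a) x y = ∀ (i : Fin d) → + lookup y i ≡ (+ lookup x i) +ℤ lookup a i
  ActStep tst x y = (x ≡ y) × (∀ (i : Fin d) → toℕ i ≡ 0 → lookup x i ≡ 0)

  data Run : Config → List Trans → Config → Set where
    run[] : ∀ {c} → Run c [] c
    run∷ : ∀ {p x q y c} {a : Act d} {π : List Trans} →
           (p , a , q) ∈ Delta V → ActStep a x y →
           Run (q , y) π c → Run (p , x) ((p , a , q) ∷ π) c

  data Consecutive : List Trans → Set where
    con[] : Consecutive []
    con1 : ∀ {t} → Consecutive (t ∷ [])
    con∷ : ∀ {t u π} → tgt t ≡ src u → Consecutive (u ∷ π) → Consecutive (t ∷ u ∷ π)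

  IsPath : List Trans → Set
  IsPath π = All (λ t → t ∈ Delta V) π × Consecutive π

  lastTgt : Trans → List Trans → State
  lastTgt t [] = tgt t
  lastTgt t (u ∷ π) = lastTgt u π

  IsCycle : List Trans → Set
  IsCycle [] = Data.Empty.⊥ where import Data.Empty
  IsCycle (t ∷ π) = IsPath (t ∷ π) × (src t ≡ lastTgt t π)

  -- A linear path scheme  α₀ β₁* α₁ ⋯ βₖ* αₖ  is given by α₀ and the list of pairs (βᵢ, αᵢ).
  record LPS : Set where
    constructor lps
    field
      α₀ : List Trans
      blocks : List (List Trans × List Trans)

  flat : LPS → List Trans
  flat (lps α₀ bs) = α₀ ++ concat (map (λ b → proj₁ b ++ proj₂ b) bs)

  IsLPS : LPS → Set
  IsLPS L = IsPath (flat L) × All (λ b → IsCycle (proj₁ b)) (LPS.blocks L)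

  size : LPS → ℕ
  size L = length (flat L)

  stars : LPS → ℕ
  stars L = length (LPS.blocks L)

  -- Language of L: words α₀ β₁^{n₁} α₁ ⋯ βₖ^{nₖ} αₖ, indexed by the exponents.
  powL : List Trans → ℕ → List Trans
  powL β n = concat (replicate n β)

  wordBlocks : List (List Trans × List Trans) → List ℕ → List Trans → Set
  wordBlocks [] [] w = w ≡ []
  wordBlocks [] (_ ∷ _) w = Data.Empty.⊥ where import Data.Empty
  wordBlocks (_ ∷ _) [] w = Data.Empty.⊥ where import Data.Empty
  wordBlocks ((β , α) ∷ bs) (n ∷ ns) w =
    ∃ λ w' → (w ≡ powL β n ++ α ++ w') × wordBlocks bs ns w'

  InLang : LPS → List Trans → Set
  InLang (lps α₀ bs) w = ∃ λ ns → ∃ λ w' → (w ≡ α₀ ++ w') × wordBlocks bs ns w'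

  ReachL : Config → LPS → Config → Set
  ReachL c L c' = ∃ λ π → InLang L π × Run c π c'

  -- L bounded from c: the set of configurations reached by prefixes of words of L is finite
  -- (i.e. contained in some finite list).
  Bounded : LPS → Config → Set
  Bounded L c = ∃ λ (cs : List Config) →
    ∀ (π σ : List Trans) (c' : Config) → InLang L (π ++ σ) → Run c π c' → c' ∈ cs

normℕ : ∀ {d} → Vec ℕ d → ℕ
normℕ = foldr _ _⊔_ 0

normℤ : ∀ {d} → Vec ℤ d → ℕ
normℤ v = foldr _ (λ z m → ∣ z ∣ ⊔ m) 0 v

normAct : ∀ {d} → Act d → ℕ
normAct (add a) = normℤ a
normAct tst = 0

normSig : ∀ {d} → List (Act d) → ℕ
normSig [] = 0
normSig (a ∷ as) = normAct a ⊔ normSig as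

module Submission where

-- Write s = ‖Σ‖ and weight π = |π|·s.  A run along π moves every counter by the
-- integer effect of π, of absolute value at most weight π (run-norm).  The heart of
-- the proof is the analysis of a cycle β iterated n times from p(u) when all
-- configurations reached along the powers of β lie in a finite list:
--   * if some counter has negative effect, that counter forces n ≤ ‖u‖;
--   * if all effects are nonnegative and one is positive and n ≥ 2, then β can be
--     pumped (monotonicity of runs w.r.t. translations that keep the tested counter
--     at 0), so the powers of β reach configurations of unbounded norm;
--   * otherwise all effects vanish.
-- Hence n·|effect| ≤ (1 + ‖u‖)·weight β, which gives the one-cycle bound
-- ‖v‖ ≤ ‖u‖ + (1 + ‖u‖)·weight β (cycle-norm).  The theorem follows by induction
-- over the blocks βᵢ* αᵢ of the scheme (blocks-norm), each block multiplying the
-- bound by at most 1 + |L|·s.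

open import Defs
open import Data.Nat using (ℕ; zero; suc; _+_; _*_; _^_; _≤_; _⊔_; _<_; _<?_; z≤n; s≤s; >-nonZero)
import Data.Nat.Properties as ℕP
open import Data.Integer as ℤ using (ℤ; +_; -[1+_]; ∣_∣) renaming (_+_ to _+ℤ_; _*_ to _*ℤ_)
import Data.Integer.Properties as ℤP
open import Data.Fin using (Fin; toℕ)
open import Data.Fin.Properties using (any?)
open import Data.Vec using (Vec; []; _∷_; lookup; tabulate)
open import Data.Vec.Properties using (tabulate∘lookup; tabulate-cong; lookup∘tabulate)
open import Data.List using (List; []; _∷_; _++_; length; concat; map; replicate)
import Data.List.Properties as ListP
open import Data.List.Membership.Propositional using (_∈_)
open import Data.List.Relation.Unary.Any using (here; there)
import Data.List.Relation.Unary.All as All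
open import Data.Product using (Σ; _×_; _,_; proj₁; proj₂)
open import Data.Sum using (_⊎_; inj₁; inj₂)
open import Data.Empty using (⊥; ⊥-elim)
open import Relation.Nullary using (yes; no)
open import Relation.Binary.PropositionalEquality

vec-ext : ∀ {d} {u v : Vec ℕ d} → (∀ i → lookup u i ≡ lookup v i) → u ≡ v
vec-ext {u = u} {v} h =
  trans (sym (tabulate∘lookup u)) (trans (tabulate-cong h) (tabulate∘lookup v))

lookup≤norm : ∀ {d} (x : Vec ℕ d) i → lookup x i ≤ normℕ x
lookup≤norm (x ∷ xs) Fin.zero = ℕP.m≤m⊔n x (normℕ xs)
lookup≤norm (x ∷ xs) (Fin.suc i) = ℕP.≤-trans (lookup≤norm xs i) (ℕP.m≤n⊔m x (normℕ xs))

norm-lub : ∀ {d} (x : Vec ℕ d) B → (∀ i → lookup x i ≤ B) → normℕ x ≤ B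
norm-lub [] B h = z≤n
norm-lub (x ∷ xs) B h = ℕP.⊔-lub (h Fin.zero) (norm-lub xs B (λ i → h (Fin.suc i)))

∣lookup∣≤normℤ : ∀ {d} (x : Vec ℤ d) i → ∣ lookup x i ∣ ≤ normℤ x
∣lookup∣≤normℤ (x ∷ xs) Fin.zero = ℕP.m≤m⊔n ∣ x ∣ (normℤ xs)
∣lookup∣≤normℤ (x ∷ xs) (Fin.suc i) =
  ℕP.≤-trans (∣lookup∣≤normℤ xs i) (ℕP.m≤n⊔m ∣ x ∣ (normℤ xs))

normAct≤normSig : ∀ {d} {a : Act d} {as} → a ∈ as → normAct a ≤ normSig as
normAct≤normSig {a = a} {as = _ ∷ as} (here refl) = ℕP.m≤m⊔n (normAct a) (normSig as)
normAct≤normSig {as = b ∷ as} (there a∈as) =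
  ℕP.≤-trans (normAct≤normSig a∈as) (ℕP.m≤n⊔m (normAct b) (normSig as))

≤+∣∣ : ∀ a b (z : ℤ) → + a ≡ + b +ℤ z → a ≤ b + ∣ z ∣
≤+∣∣ a b z eq = subst (λ w → ∣ w ∣ ≤ b + ∣ z ∣) (sym eq) (ℤP.∣i+j∣≤∣i∣+∣j∣ (+ b) z)

≤-of-negative-drop : ∀ v u n (z : ℤ) → z ℤ.< + 0 → + v ≡ + u +ℤ + n *ℤ z → n ≤ u
≤-of-negative-drop v u n (+ _) (ℤ.+<+ ())
≤-of-negative-drop v u n -[1+ m ] _ eq =
  ℕP.≤-trans (ℕP.m≤m*n n (suc m)) (ℕP.≤-trans (ℕP.m≤n+m (n * suc m) v) (ℕP.≤-reflexive v+drop≡u))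
  where
    cancel : ∀ (u n k : ℤ) → (u +ℤ n *ℤ ℤ.- k) +ℤ n *ℤ k ≡ u
    cancel = solve-∀ where open import Data.Integer.Tactic.RingSolver
    v+drop≡u : v + n * suc m ≡ u
    v+drop≡u = ℤP.+-injective (begin
      + (v + n * suc m)              ≡⟨ trans (ℤP.pos-+ v _) (cong (+ v +ℤ_) (ℤP.pos-* n (suc m))) ⟩
      + v +ℤ + n *ℤ + suc m          ≡⟨ cong (_+ℤ + n *ℤ + suc m) eq ⟩
      (+ u +ℤ + n *ℤ -[1+ m ]) +ℤ + n *ℤ + suc m ≡⟨ cancel (+ u) (+ n) (+ suc m) ⟩
      + u                            ∎)
      where open ≡-Reasoning

_⊞_ : ∀ {d} → Vec ℕ d → (Fin d → ℕ) → Vec ℕ d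
x ⊞ e = tabulate (λ i → lookup x i + e i)

lookup-⊞ : ∀ {d} (x : Vec ℕ d) e i → lookup (x ⊞ e) i ≡ lookup x i + e i
lookup-⊞ x e i = lookup∘tabulate (λ i → lookup x i + e i) i

concat-replicate-suc : ∀ {A : Set} (β : List A) k →
  concat (replicate (suc k) β) ≡ concat (replicate k β) ++ β
concat-replicate-suc β zero = ListP.++-identityʳ β
concat-replicate-suc β (suc k) =
  trans (cong (β ++_) (concat-replicate-suc β k)) (sym (ListP.++-assoc β (concat (replicate k β)) β))

-- The arithmetic of one block βᵢ* αᵢ: the bound X on the configuration after it,
-- together with the remaining weight r, fits into one factor 1 + M.
block-arith : ∀ {X} U b a r M → X ≤ U + (1 + U) * b + a → b + a + r ≤ M →
              X + r ≤ (U + (b + a + r)) * (1 + M)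
block-arith {X} U b a r M hX hM = begin
    X + r                          ≤⟨ ℕP.+-monoˡ-≤ r hX ⟩
    U + (1 + U) * b + a + r        ≡⟨ regroup U b a r ⟩
    A + U * b                      ≤⟨ ℕP.+-monoʳ-≤ A (ℕP.*-mono-≤ (ℕP.m≤m+n U _) b≤M) ⟩
    A + A * M                      ≡⟨ sym (ℕP.*-suc A M) ⟩
    A * (1 + M)                    ∎
  where
    open ℕP.≤-Reasoning
    A = U + (b + a + r)
    regroup : ∀ U b a r → U + (1 + U) * b + a + r ≡ (U + (b + a + r)) + U * b
    regroup = solve-∀ where open import Data.Nat.Tactic.RingSolver
    b≤M : b ≤ M
    b≤M = ℕP.≤-trans (ℕP.≤-trans (ℕP.m≤m+n b a) (ℕP.m≤m+n (b + a) r)) hM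

module Runs {d : ℕ} (V : TVASS d) where

  s : ℕ
  s = normSig (Sig V)

  -- weight π = |π|·‖Σ‖ bounds the change of any counter along π.
  weight : List (Trans V) → ℕ
  weight π = length π * s

  weight-++ : ∀ π σ → weight (π ++ σ) ≡ weight π + weight σ
  weight-++ π σ = trans (cong (_* s) (ListP.length-++ π)) (ℕP.*-distribʳ-+ s (length π) (length σ))

  run-++ : ∀ {c π c' σ c''} → Run V c π c' → Run V c' σ c'' → Run V c (π ++ σ) c''
  run-++ run[] r = r
  run-++ (run∷ t∈Δ step r) r' = run∷ t∈Δ step (run-++ r r')

  run-split : ∀ {c} π {σ c''} → Run V c (π ++ σ) c'' →
              Σ (Config V) λ c' → Run V c π c' × Run V c' σ c''
  run-split [] r = _ , run[] , r
  run-split (t ∷ π) (run∷ t∈Δ step r) with run-split π r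
  ... | c' , r₁ , r₂ = c' , run∷ t∈Δ step r₁ , r₂

  -- If a path can be taken twice in a row, the first traversal ends in the state
  -- where it began (both start in the source of its first transition).
  cycle-returns : ∀ {β p u p₁ u₁ c₂} → Run V (p , u) β (p₁ , u₁) → Run V (p₁ , u₁) β c₂ → p₁ ≡ p
  cycle-returns run[] _ = refl
  cycle-returns (run∷ _ _ _) (run∷ _ _ _) = refl

  effect : List (Trans V) → Fin d → ℤ
  effect [] i = + 0
  effect ((_ , add a , _) ∷ π) i = lookup a i +ℤ effect π i
  effect ((_ , tst , _) ∷ π) i = effect π i

  effect-++ : ∀ π σ i → effect (π ++ σ) i ≡ effect π i +ℤ effect σ i
  effect-++ [] σ i = sym (ℤP.+-identityˡ _)
  effect-++ ((_ , add a , _) ∷ π) σ i =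
    trans (cong (lookup a i +ℤ_) (effect-++ π σ i)) (sym (ℤP.+-assoc (lookup a i) (effect π i) (effect σ i)))
  effect-++ ((_ , tst , _) ∷ π) σ i = effect-++ π σ i

  effect-pow : ∀ β n i → effect (powL V β n) i ≡ + n *ℤ effect β i
  effect-pow β zero i = refl
  effect-pow β (suc n) i =
    trans (effect-++ β (powL V β n) i)
      (trans (cong (effect β i +ℤ_) (effect-pow β n i)) (sym (ℤP.suc-* (+ n) (effect β i))))

  run-effect : ∀ {c π c'} → Run V c π c' →
               ∀ i → + lookup (proj₂ c') i ≡ + lookup (proj₂ c) i +ℤ effect π i
  run-effect run[] i = sym (ℤP.+-identityʳ _)
  run-effect {c = _ , x} (run∷ {a = add a} {π = π} _ step r) i =
    trans (run-effect r i)
      (trans (cong (_+ℤ effect π i) (step i)) (ℤP.+-assoc (+ lookup x i) (lookup a i) (effect π i)))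
  run-effect (run∷ {a = tst} _ (refl , _) r) i = run-effect r i

  run-pow-effect : ∀ β n {c c'} → Run V c (powL V β n) c' →
                   ∀ i → + lookup (proj₂ c') i ≡ + lookup (proj₂ c) i +ℤ + n *ℤ effect β i
  run-pow-effect β n {c} r i = trans (run-effect r i) (cong (+ lookup (proj₂ c) i +ℤ_) (effect-pow β n i))

  effect-bound : ∀ {c π c'} → Run V c π c' → ∀ i → ∣ effect π i ∣ ≤ weight π
  effect-bound run[] i = z≤n
  effect-bound (run∷ {a = add a} {π = π} t∈Δ _ r) i =
    ℕP.≤-trans (ℤP.∣i+j∣≤∣i∣+∣j∣ (lookup a i) (effect π i))
      (ℕP.+-mono-≤ (ℕP.≤-trans (∣lookup∣≤normℤ a i) (normAct≤normSig (All.lookup (Delta⊆QΣQ V) t∈Δ)))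
                   (effect-bound r i))
  effect-bound (run∷ {a = tst} {π = π} _ _ r) i = ℕP.≤-trans (effect-bound r i) (ℕP.m≤n+m (weight π) s)

  run-norm : ∀ {c π c'} → Run V c π c' → normℕ (proj₂ c') ≤ normℕ (proj₂ c) + weight π
  run-norm {_ , x} {π} {_ , y} r = norm-lub y _ λ i →
    ℕP.≤-trans (≤+∣∣ (lookup y i) (lookup x i) (effect π i) (run-effect r i))
      (ℕP.+-mono-≤ (lookup≤norm x i) (effect-bound r i))

  -- Additions commute with translations; the run from x + e witnesses that e is 0
  -- on the tested counter at every zero test.
  run-translate : ∀ {c π c' c₂} (e f : Fin d → ℕ) → (∀ i → toℕ i ≡ 0 → e i ≡ 0 → f i ≡ 0) →
                  Run V c π c' → Run V (proj₁ c , proj₂ c ⊞ e) π c₂ →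
                  Run V (proj₁ c , proj₂ c ⊞ f) π (proj₁ c' , proj₂ c' ⊞ f)
  run-translate e f h run[] _ = run[]
  run-translate {c = _ , x} e f h (run∷ {y = y} {a = add a} {π = π} t∈Δ step r) (run∷ {y = z} _ step' r') =
    run∷ t∈Δ (translate-add f) (run-translate e f h r (subst (λ w → Run V (_ , w) π _) z≡y⊞e r'))
    where
      translate-add : ∀ g i → + lookup (y ⊞ g) i ≡ + lookup (x ⊞ g) i +ℤ lookup a i
      translate-add g i = begin
        + lookup (y ⊞ g) i                      ≡⟨ trans (cong +_ (lookup-⊞ y g i)) (ℤP.pos-+ (lookup y i) (g i)) ⟩
        + lookup y i +ℤ + g i                   ≡⟨ cong (_+ℤ + g i) (step i) ⟩
        (+ lookup x i +ℤ lookup a i) +ℤ + g i   ≡⟨ swap (+ lookup x i) (lookup a i) (+ g i) ⟩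
        (+ lookup x i +ℤ + g i) +ℤ lookup a i   ≡⟨ cong (_+ℤ lookup a i) (sym (trans (cong +_ (lookup-⊞ x g i))
                                                                                 (ℤP.pos-+ (lookup x i) (g i)))) ⟩
        + lookup (x ⊞ g) i +ℤ lookup a i        ∎
        where
          open ≡-Reasoning
          swap : ∀ (x a g : ℤ) → (x +ℤ a) +ℤ g ≡ (x +ℤ g) +ℤ a
          swap = solve-∀ where open import Data.Integer.Tactic.RingSolver
      z≡y⊞e : z ≡ y ⊞ e
      z≡y⊞e = vec-ext λ i → ℤP.+-injective (trans (step' i) (sym (translate-add e i)))
  run-translate {c = _ , x} e f h (run∷ {a = tst} t∈Δ (refl , x₁≡0) r) (run∷ _ (refl , x₁+e₁≡0) r') =
    run∷ t∈Δ (refl , translated-test) (run-translate e f h r r')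
    where
      translated-test : ∀ i → toℕ i ≡ 0 → lookup (x ⊞ f) i ≡ 0
      translated-test i i≡0 = trans (lookup-⊞ x f i) (cong₂ _+_ (x₁≡0 i i≡0)
        (h i i≡0 (ℕP.m+n≡0⇒n≡0 (lookup x i) (trans (sym (lookup-⊞ x e i)) (x₁+e₁≡0 i i≡0)))))

  pump : ∀ {β p u c₂} (e : Fin d → ℕ) → Run V (p , u) β (p , u ⊞ e) → Run V (p , u ⊞ e) β c₂ →
         ∀ k → Run V (p , u) (powL V β k) (p , u ⊞ (λ i → k * e i))
  pump {p = p} {u} e _ _ zero =
    subst (λ w → Run V (p , u) [] (p , w)) (vec-ext λ i → sym (trans (lookup-⊞ u _ i) (ℕP.+-identityʳ _))) run[]
  pump {β} {p} {u} e r₁ r₂ (suc k) =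
    subst₂ (λ π w → Run V (p , u) π (p , w)) (sym (concat-replicate-suc β k)) u+e+ke≡u+[1+k]e
      (run-++ (pump e r₁ r₂ k) (run-translate e ke (λ i _ eᵢ≡0 → trans (cong (k *_) eᵢ≡0) (ℕP.*-zeroʳ k)) r₁ r₂))
    where
      ke : Fin d → ℕ
      ke i = k * e i
      u+e+ke≡u+[1+k]e : (u ⊞ e) ⊞ ke ≡ u ⊞ (λ i → suc k * e i)
      u+e+ke≡u+[1+k]e = vec-ext λ i → begin
        lookup ((u ⊞ e) ⊞ ke) i   ≡⟨ trans (lookup-⊞ (u ⊞ e) ke i) (cong (_+ k * e i) (lookup-⊞ u e i)) ⟩
        lookup u i + e i + k * e i ≡⟨ ℕP.+-assoc (lookup u i) (e i) (k * e i) ⟩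
        lookup u i + suc k * e i  ≡⟨ sym (lookup-⊞ u _ i) ⟩
        lookup (u ⊞ _) i          ∎
        where open ≡-Reasoning

  PowersBounded : List (Trans V) → Config V → List (Config V) → Set
  PowersBounded β c cs = ∀ m c' → Run V c (powL V β m) c' → c' ∈ cs

  maxNorm : List (Config V) → ℕ
  maxNorm [] = 0
  maxNorm (c ∷ cs) = normℕ (proj₂ c) ⊔ maxNorm cs

  ∈⇒≤maxNorm : ∀ {c cs} → c ∈ cs → normℕ (proj₂ c) ≤ maxNorm cs
  ∈⇒≤maxNorm {c} {_ ∷ cs} (here refl) = ℕP.m≤m⊔n (normℕ (proj₂ c)) (maxNorm cs)
  ∈⇒≤maxNorm {cs = c' ∷ cs} (there c∈cs) =
    ℕP.≤-trans (∈⇒≤maxNorm c∈cs) (ℕP.m≤n⊔m (normℕ (proj₂ c')) (maxNorm cs))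

  -- A pumpable cycle with a positive effect reaches configurations of unbounded
  -- norm, which no finite list can contain.
  pumpable-unbounded : ∀ {β p u c₂ cs} (e : Fin d → ℕ) → PowersBounded β (p , u) cs →
    Run V (p , u) β (p , u ⊞ e) → Run V (p , u ⊞ e) β c₂ → ∀ k₀ → 0 < e k₀ → ⊥
  pumpable-unbounded {u = u} {cs = cs} e bounded r₁ r₂ k₀ eₖ₀>0 =
    ℕP.<-irrefl refl (ℕP.≤-trans (s≤s K≤norm) (s≤s (∈⇒≤maxNorm (bounded K _ (pump e r₁ r₂ K)))))
    where
      K = suc (maxNorm cs)
      Ke : Fin d → ℕ
      Ke i = K * e i
      K≤norm : K ≤ normℕ (u ⊞ Ke)
      K≤norm = begin
        K                        ≤⟨ ℕP.m≤m*n K (e k₀) ⦃ >-nonZero eₖ₀>0 ⦄ ⟩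
        K * e k₀                 ≤⟨ ℕP.m≤n+m (K * e k₀) (lookup u k₀) ⟩
        lookup u k₀ + K * e k₀   ≡⟨ sym (lookup-⊞ u Ke k₀) ⟩
        lookup (u ⊞ Ke) k₀       ≤⟨ lookup≤norm (u ⊞ Ke) k₀ ⟩
        normℕ (u ⊞ Ke)           ∎
        where open ℕP.≤-Reasoning

  iterations-dichotomy : ∀ β n {p u c'} {cs} → PowersBounded β (p , u) cs →
    Run V (p , u) (powL V β n) c' → n ≤ suc (normℕ u) ⊎ (∀ k → ∣ effect β k ∣ ≡ 0)
  iterations-dichotomy β n {p} {u} {c'} bounded r
    with any? (λ k → effect β k ℤ.<? + 0)
  ... | yes (k , negative) =
    inj₁ (ℕP.m≤n⇒m≤1+n (ℕP.≤-trans
      (≤-of-negative-drop (lookup (proj₂ c') k) (lookup u k) n (effect β k) negative (run-pow-effect β n r k))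
      (lookup≤norm u k)))
  ... | no no-negative with any? (λ k → 0 <? ∣ effect β k ∣)
  ...   | no no-positive = inj₂ λ k → ℕP.n≤0⇒n≡0 (ℕP.≮⇒≥ (λ pos → no-positive (k , pos)))
  ...   | yes (k₀ , positive) = inj₁ (at-most-once n r)
    where
      E : Fin d → ℕ
      E k = ∣ effect β k ∣
      -- With nonnegative effects, one round of β from u ends at u + E.
      one-round : ∀ {x c} → Run V (p , u) β (x , c) → c ≡ u ⊞ E
      one-round {c = c} r₁ = vec-ext λ k → ℤP.+-injective (begin
        + lookup c k                     ≡⟨ run-effect r₁ k ⟩
        + lookup u k +ℤ effect β k       ≡⟨ cong (+ lookup u k +ℤ_) (sym (ℤP.0≤i⇒+∣i∣≡i
                                              (ℤP.≮⇒≥ (λ neg → no-negative (k , neg))))) ⟩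
        + lookup u k +ℤ + E k            ≡⟨ sym (trans (cong +_ (lookup-⊞ u E k)) (ℤP.pos-+ (lookup u k) (E k))) ⟩
        + lookup (u ⊞ E) k               ∎)
        where open ≡-Reasoning
      -- Two rounds of β would make β pumpable, contradicting boundedness.
      at-most-once : ∀ m → Run V (p , u) (powL V β m) c' → m ≤ suc (normℕ u)
      at-most-once zero _ = z≤n
      at-most-once (suc zero) _ = s≤s z≤n
      at-most-once (suc (suc m)) r₁₂ with run-split β r₁₂
      ... | _ , r₁ , rest with run-split β rest
      ...   | _ , r₂ , _ with cycle-returns r₁ r₂ | one-round r₁
      ...     | refl | refl = ⊥-elim (pumpable-unbounded E bounded r₁ r₂ k₀ positive)

  cycle-norm : ∀ β n {p u c'} {cs} → PowersBounded β (p , u) cs → Run V (p , u) (powL V β n) c' →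
               normℕ (proj₂ c') ≤ normℕ u + (1 + normℕ u) * weight β
  cycle-norm β n {p} {u} {c'} bounded r = norm-lub (proj₂ c') _ λ k → begin
      lookup (proj₂ c') k                ≤⟨ ≤+∣∣ (lookup (proj₂ c') k) (lookup u k) (+ n *ℤ effect β k) (run-pow-effect β n r k) ⟩
      lookup u k + ∣ + n *ℤ effect β k ∣ ≡⟨ cong (_+_ (lookup u k)) (ℤP.abs-* (+ n) (effect β k)) ⟩
      lookup u k + n * ∣ effect β k ∣    ≤⟨ ℕP.+-mono-≤ (lookup≤norm u k) (iterated n k r (iterations-dichotomy β n bounded r)) ⟩
      normℕ u + (1 + normℕ u) * weight β ∎
    where
      open ℕP.≤-Reasoning
      -- In both cases of the dichotomy, m·|effect| ≤ (1 + ‖u‖)·weight β; for m ≥ 1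
      -- the run contains a round of β, which bounds its effect.
      iterated : ∀ m k → Run V (p , u) (powL V β m) c' → m ≤ suc (normℕ u) ⊎ (∀ k → ∣ effect β k ∣ ≡ 0) →
                 m * ∣ effect β k ∣ ≤ (1 + normℕ u) * weight β
      iterated zero k _ _ = z≤n
      iterated (suc m) k rᵐ (inj₁ m≤1+‖u‖) =
        ℕP.*-mono-≤ m≤1+‖u‖ (effect-bound (proj₁ (proj₂ (run-split β rᵐ))) k)
      iterated m k _ (inj₂ no-effect) rewrite no-effect k | ℕP.*-zeroʳ m = z≤n

  Blocks : Set
  Blocks = List (List (Trans V) × List (Trans V))

  blocksPath : Blocks → List (Trans V)
  blocksPath bs = concat (map (λ b → proj₁ b ++ proj₂ b) bs)

  weight-block : ∀ β α bs →
    weight (blocksPath ((β , α) ∷ bs)) ≡ weight β + weight α + weight (blocksPath bs)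
  weight-block β α bs = trans (weight-++ (β ++ α) (blocksPath bs)) (cong (_+ weight (blocksPath bs)) (weight-++ β α))

  BlocksBounded : Config V → Blocks → Set
  BlocksBounded c bs = Σ (List (Config V)) λ cs →
    ∀ ns π σ c' → wordBlocks V bs ns (π ++ σ) → Run V c π c' → c' ∈ cs

  -- Every list of blocks spells some word (take all exponents 0).
  some-word : ∀ bs → Σ (List ℕ) λ ns → Σ (List (Trans V)) λ w → wordBlocks V bs ns w
  some-word [] = [] , [] , refl
  some-word ((β , α) ∷ bs) with some-word bs
  ... | ns , w , w∈bs = 0 ∷ ns , α ++ w , w , refl , w∈bs

  -- Powers of the leading cycle are prefixes of words, hence bounded.
  leading-powers-bounded : ∀ {c β α bs} (bounded : BlocksBounded c ((β , α) ∷ bs)) →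
                           PowersBounded β c (proj₁ bounded)
  leading-powers-bounded {β = β} {α} {bs} (cs , bounded) m c' r with some-word bs
  ... | ns , w , w∈bs = bounded (m ∷ ns) (powL V β m) (α ++ w) c' (w , refl , w∈bs) r

  remaining-bounded : ∀ {c c₂ β α bs n} → BlocksBounded c ((β , α) ∷ bs) →
                      Run V c (powL V β n ++ α) c₂ → BlocksBounded c₂ bs
  remaining-bounded {β = β} {α} {n = n} (cs , bounded) r =
    cs , λ ns π σ c' w∈bs r' → bounded (n ∷ ns) ((powL V β n ++ α) ++ π) σ c'
      (π ++ σ , reassoc π σ , w∈bs) (run-++ r r')
    where
      reassoc : ∀ π σ → ((powL V β n ++ α) ++ π) ++ σ ≡ powL V β n ++ α ++ π ++ σ
      reassoc π σ = trans (ListP.++-assoc (powL V β n ++ α) π σ) (ListP.++-assoc (powL V β n) α (π ++ σ))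

  blocks-bounded : ∀ {c c₀ α₀ bs} → Bounded V (lps α₀ bs) c → Run V c α₀ c₀ → BlocksBounded c₀ bs
  blocks-bounded {α₀ = α₀} (cs , bounded) r =
    cs , λ ns π σ c' w∈bs r' →
      bounded (α₀ ++ π) σ c' (ns , π ++ σ , ListP.++-assoc α₀ π σ , w∈bs) (run-++ r r')

  blocks-norm : ∀ M bs ns w {c c'} → wordBlocks V bs ns w → Run V c w c' → BlocksBounded c bs →
    weight (blocksPath bs) ≤ M →
    normℕ (proj₂ c') ≤ (normℕ (proj₂ c) + weight (blocksPath bs)) * (1 + M) ^ length bs
  blocks-norm M [] [] .[] refl run[] _ _ = ℕP.≤-trans (ℕP.m≤m+n _ 0) (ℕP.m≤m*n _ 1)
  blocks-norm M ((β , α) ∷ bs) (n ∷ ns) w {c} {c'} (w' , refl , w'∈bs) r bounded W≤M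
    with run-split (powL V β n) r
  ... | c₁ , r₁ , r' with run-split α r'
  ... | c₂ , r₂ , r₃ = begin
      normℕ (proj₂ c')              ≤⟨ blocks-norm M bs ns w' w'∈bs r₃ (remaining-bounded {n = n} bounded (run-++ r₁ r₂))
                                         (ℕP.≤-trans R≤W W≤M) ⟩
      (normℕ (proj₂ c₂) + R) * P     ≤⟨ ℕP.*-monoˡ-≤ P one-block ⟩
      (U + W) * (1 + M) * P          ≡⟨ ℕP.*-assoc (U + W) (1 + M) P ⟩
      (U + W) * ((1 + M) * P)        ∎
    where
      open ℕP.≤-Reasoning
      U = normℕ (proj₂ c)
      W = weight (blocksPath ((β , α) ∷ bs))
      R = weight (blocksPath bs)
      P = (1 + M) ^ length bs
      R≤W : R ≤ W
      R≤W = subst (R ≤_) (sym (weight-block β α bs)) (ℕP.m≤n+m R (weight β + weight α))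
      after-block : normℕ (proj₂ c₂) ≤ U + (1 + U) * weight β + weight α
      after-block = ℕP.≤-trans (run-norm r₂)
        (ℕP.+-monoˡ-≤ (weight α) (cycle-norm β n (leading-powers-bounded bounded) r₁))
      one-block : normℕ (proj₂ c₂) + R ≤ (U + W) * (1 + M)
      one-block = subst (λ X → normℕ (proj₂ c₂) + R ≤ (U + X) * (1 + M)) (sym (weight-block β α bs))
        (block-arith U (weight β) (weight α) R M after-block (subst (_≤ M) (weight-block β α bs) W≤M))

-- Split off the initial path α₀, bound its growth by run-norm, and bound the rest
-- by blocks-norm with M = |L|·‖Σ‖.
mainTheorem6 : (d : ℕ) (V : TVASS d) (L : LPS V) → IsLPS V L →
    (p : Fin (nQ V)) (x : Vec ℕ d) → Bounded V L (p , x) →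
    (q : Fin (nQ V)) (y : Vec ℕ d) → ReachL V (p , x) L (q , y) →
    normℕ y ≤ (normℕ x + size V L * normSig (Sig V)) * (1 + size V L * normSig (Sig V)) ^ stars V L
mainTheorem6 d V (lps α₀ bs) _ p x bounded q y (_ , (ns , w , refl , w∈bs) , r)
  with Runs.run-split V α₀ r
... | c₀ , r₀ , r' = begin
    normℕ y                              ≤⟨ blocks-norm M bs ns w w∈bs r' (blocks-bounded bounded r₀)
                                              (ℕP.≤-trans (ℕP.m≤n+m R (weight α₀)) (ℕP.≤-reflexive M≡)) ⟩
    (normℕ (proj₂ c₀) + R) * P           ≤⟨ ℕP.*-monoˡ-≤ P (ℕP.+-monoˡ-≤ R (run-norm r₀)) ⟩
    (normℕ x + weight α₀ + R) * P        ≡⟨ cong (_* P) (trans (ℕP.+-assoc (normℕ x) (weight α₀) R)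
                                                               (cong (_+_ (normℕ x)) M≡)) ⟩
    (normℕ x + M) * P                    ∎
  where
    open ℕP.≤-Reasoning
    open Runs V
    R = weight (blocksPath bs)
    M = weight (α₀ ++ blocksPath bs)
    P = (1 + M) ^ length bs
    M≡ : weight α₀ + R ≡ M
    M≡ = sym (weight-++ α₀ (blocksPath bs))
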